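{- Let $\pi$ be a rigid $321$-avoiding permutation and $\tau$ a $321$-avoiding permutation. Suppose that $e:\pi\to\tau$ is an embedding, $f:\pi\to\tau$ is a rigid mapping, and $f(x)\le e(x)$ for all points $x\in\pi$. Then for all $x\in\pi$, \[\max\{ f(x^{\leftarrow})^{\rightarrow}_{T(x)},\ f(x^{\downarrow})^{\uparrow}_{T(x)}\}\le e(x),\] where $\max\{y,\bot\}=y$ and $\max\{\bot\}=0$.
   Context: Permutations are sets of points $(i,\pi(i))$; an embedding of $\pi$ into $\tau$ is an injective map on points preserving relative horizontal and vertical order of every pair. In a $321$-avoiding permutation $\sigma$, a point is an upper element if it plays the role of the $2$ in some occurrence of the pattern $21$ (i.e. some point lies to its right and below it), and a lower element if it plays the role of the $1$ in some occurrence of $21$. $U_\sigma$ and $L_\sigma$ denote the sets of upper and lower elements; $\sigma$ is rigid if every point is upper or lower. The type $T(x)$ of a point is $U$ if $x\in U_\sigma$ and $L$ if $x\in L_\sigma$. A rigid mapping $f:\pi\to\tau$ is a map sending $U_\pi$ into $U_\tau$ and $L_\pi$ into $L_\tau$ (not necessarily injective). On each of $U_\tau$ and $L_\tau$ the order $x\le y$ means $y=x$ or $y$ lies above and to the right of $x$ (a linear order). For a point $x$: $x^{\leftarrow}$ is the point immediately to its left, $x^{\downarrow}$ the point immediately below it; for $b\in\{U,L\}$, $x^{\rightarrow}_b$ is the leftmost element of type $b$ strictly to the right of $x$ and $x^{\uparrow}_b$ is the lowest element of type $b$ strictly above $x$. Undefined values are denoted $\bot$, and any operator applied to $\bot$ yields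 $\bot$. -}

module Defs where

open import Data.Nat using (ℕ; zero; suc)
open import Data.Bool using (Bool; true; false; if_then_else_; _∧_)
open import Data.Fin using (Fin; zero; suc; _<_; _≤?_; _<?_; inject₁)
open import Data.Fin.Properties using (any?)
open import Data.Fin.Permutation using (Permutation′; _⟨$⟩ʳ_; _⟨$⟩ˡ_)
open import Data.Maybe using (Maybe; just; nothing; _>>=_)
open import Data.Product using (Σ; ∃; _×_; _,_)
open import Data.Sum using (_⊎_)
open import Data.Unit using (⊤)
open import Data.Empty using (⊥)
open import Relation.Nullary using (¬_; Dec; yes; no)
open import Relation.Nullary.Decidable using (⌊_⌋; _×-dec_)
open import Relation.Binary.PropositionalEquality using (_≡_)

-- A permutation σ of size n is a bijection Fin n ↔ Fin n; its points are
-- (i , σ(i)).  A point is identified with its column i : Fin n.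
-- σ ⟨$⟩ʳ i is the value (height) of the point in column i,
-- σ ⟨$⟩ˡ v is the column of the point of height v.

Avoids321 : ∀ {n} → Permutation′ n → Set
Avoids321 {n} σ = ¬ (Σ (Fin n) λ i → Σ (Fin n) λ j → Σ (Fin n) λ k →
  i < j × j < k × (σ ⟨$⟩ʳ k) < (σ ⟨$⟩ʳ j) × (σ ⟨$⟩ʳ j) < (σ ⟨$⟩ʳ i))

Upper : ∀ {n} → Permutation′ n → Fin n → Set
Upper {n} σ i = ∃ λ (j : Fin n) → i < j × (σ ⟨$⟩ʳ j) < (σ ⟨$⟩ʳ i)

Lower : ∀ {n} → Permutation′ n → Fin n → Set
Lower {n} σ i = ∃ λ (j : Fin n) → j < i × (σ ⟨$⟩ʳ i) < (σ ⟨$⟩ʳ j)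

upper? : ∀ {n} (σ : Permutation′ n) (i : Fin n) → Dec (Upper σ i)
upper? σ i = any? λ j → (i <? j) ×-dec ((σ ⟨$⟩ʳ j) <? (σ ⟨$⟩ʳ i))

lower? : ∀ {n} (σ : Permutation′ n) (i : Fin n) → Dec (Lower σ i)
lower? σ i = any? λ j → (j <? i) ×-dec ((σ ⟨$⟩ʳ i) <? (σ ⟨$⟩ʳ j))

Rigid : ∀ {n} → Permutation′ n → Set
Rigid {n} σ = (i : Fin n) → Upper σ i ⊎ Lower σ i

data Ty : Set where
  U L : Ty

HasType : ∀ {n} → Permutation′ n → Ty → Fin n → Set
HasType σ U i = Upper σ i
HasType σ L i = Lower σ i

hasType? : ∀ {n} (σ : Permutation′ n) (b : Ty) (i : Fin n) → Bool
hasType? σ U i = ⌊ upper? σ i ⌋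
hasType? σ L i = ⌊ lower? σ i ⌋

-- T(x): U if x is upper, L otherwise (for rigid 321-avoiding σ, the
-- non-upper points are exactly the lower ones)
T : ∀ {n} → Permutation′ n → Fin n → Ty
T σ i = if ⌊ upper? σ i ⌋ then U else L

IsEmbedding : ∀ {n m} → Permutation′ n → Permutation′ m → (Fin n → Fin m) → Set
IsEmbedding {n} π τ e = (i j : Fin n) →
  (i < j → e i < e j) × ((π ⟨$⟩ʳ i) < (π ⟨$⟩ʳ j) → (τ ⟨$⟩ʳ e i) < (τ ⟨$⟩ʳ e j))

IsRigidMapping : ∀ {n m} → Permutation′ n → Permutation′ m → (Fin n → Fin m) → Set
IsRigidMapping {n} π τ f = (i : Fin n) →
  (Upper π i → Upper τ (f i)) × (Lower π i → Lower τ (f i))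

_≼[_]_ : ∀ {m} → Fin m → Permutation′ m → Fin m → Set
x ≼[ τ ] y = (y ≡ x) ⊎ (x < y × (τ ⟨$⟩ʳ x) < (τ ⟨$⟩ʳ y))

predFin : ∀ {n} → Fin n → Maybe (Fin n)
predFin zero    = nothing
predFin (suc i) = just (inject₁ i)

findFirst : ∀ {m} → (Fin m → Bool) → Maybe (Fin m)
findFirst {zero}  p = nothing
findFirst {suc m} p = if p zero then just zero
                      else (findFirst (λ i → p (suc i)) >>= λ j → just (suc j))

left : ∀ {n} → Permutation′ n → Fin n → Maybe (Fin n)
left σ i = predFin i

down : ∀ {n} → Permutation′ n → Fin n → Maybe (Fin n)
down σ i = predFin (σ ⟨$⟩ʳ i) >>= λ v → just (σ ⟨$⟩ˡ v)

rightOf : ∀ {m} → Permutation′ m → Ty → Fin m → Maybe (Fin m)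
rightOf σ b x = findFirst (λ j → ⌊ x <? j ⌋ ∧ hasType? σ b j)

upOf : ∀ {m} → Permutation′ m → Ty → Fin m → Maybe (Fin m)
upOf σ b x = findFirst (λ v → ⌊ (σ ⟨$⟩ʳ x) <? v ⌋ ∧ hasType? σ b (σ ⟨$⟩ˡ v))
             >>= λ v → just (σ ⟨$⟩ˡ v)

-- Two defined points are compared by column (within U_τ or within L_τ of a
-- 321-avoiding τ this coincides with the linear order ≼).
maxM : ∀ {m} → Maybe (Fin m) → Maybe (Fin m) → Maybe (Fin m)
maxM nothing  b        = b
maxM (just a) nothing  = just a
maxM (just a) (just b) = if ⌊ a ≤? b ⌋ then just b else just a

-- "max ≤ z" where the value nothing stands for 0, which is ≤ everything
_≼M[_]_ : ∀ {m} → Maybe (Fin m) → Permutation′ m → Fin m → Set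
nothing ≼M[ τ ] z = ⊤
just y  ≼M[ τ ] z = y ≼[ τ ] z

-- The embedding e sends x to a point of the same type T(x) in τ.  Since
-- f(x^←) ≤ e(x^←) lies strictly left of e(x), the point e(x) is a candidate
-- for f(x^←)^→_{T(x)}, so the leftmost candidate is not to the right of e(x);
-- dually f(x^↓)^↑_{T(x)} is not above e(x).  In a 321-avoiding permutation
-- the points of one type form an increasing sequence, so comparing them by
-- column alone, or by value alone, already decides the order ≤.
module Submission where

open import Defs
open import Data.Nat using (ℕ; suc; z≤n; s≤s)
open import Data.Fin using (Fin; zero; suc; _<_; _≤_; _<?_; _≤?_)
open import Data.Fin.Permutation using (Permutation′; _⟨$⟩ʳ_; _⟨$⟩ˡ_; inverseˡ; inverseʳ)
open import Data.Maybe using (Maybe; just; nothing; _>>=_)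

open import Data.Bool using (Bool; true; false; _∧_) renaming (T to IsTrue)
open import Data.Empty using (⊥-elim)
open import Data.Fin.Properties using (<-cmp; <-irrefl; ≤̄⇒inject₁<)
import Data.Nat.Properties as ℕₚ
open import Data.Product using (∃; _×_; _,_; proj₁; proj₂)
open import Data.Sum using (inj₁; inj₂)
open import Data.Unit using (tt)
open import Function using (_∘_)
open import Relation.Binary.Definitions using (tri<; tri≈; tri>)
open import Relation.Binary.PropositionalEquality
  using (_≡_; refl; sym; trans; cong; subst)
open import Relation.Nullary using (Dec; yes; no)
open import Relation.Nullary.Decidable using (⌊_⌋; toWitness; fromWitness)

>>=-just : ∀ {A B : Set} {m : Maybe A} {g : A → Maybe B} {r : B} →
  (m >>= g) ≡ just r → ∃ λ y → m ≡ just y × g y ≡ just r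
>>=-just {m = just y} eq = y , refl , eq

findFirst-sound : ∀ {m} (p : Fin m → Bool) {r} → findFirst p ≡ just r → IsTrue (p r)
findFirst-sound {suc m} p eq with p zero in p0
findFirst-sound {suc m} p refl | true rewrite p0 = tt
... | false with findFirst (p ∘ suc) in eq′
findFirst-sound {suc m} p refl | false | just r = findFirst-sound (p ∘ suc) eq′

findFirst-least : ∀ {m} (p : Fin m → Bool) {r} → findFirst p ≡ just r →
  ∀ {j} → IsTrue (p j) → r ≤ j
findFirst-least {suc m} p eq {j} pj with p zero in p0
findFirst-least {suc m} p refl pj | true = z≤n
... | false with findFirst (p ∘ suc) in eq′
findFirst-least {suc m} p refl {zero} pj | false | just r rewrite p0 = ⊥-elim pj
findFirst-least {suc m} p refl {suc j} pj | false | just r =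
  s≤s (findFirst-least (p ∘ suc) eq′ pj)

module _ {m} {σ : Permutation′ m} where

  hasType-sound : ∀ {b i} → IsTrue (hasType? σ b i) → HasType σ b i
  hasType-sound {U} = toWitness
  hasType-sound {L} = toWitness

  hasType-complete : ∀ {b i} → HasType σ b i → IsTrue (hasType? σ b i)
  hasType-complete {U} = fromWitness
  hasType-complete {L} = fromWitness

  ⟨$⟩ʳ-injective : ∀ {a c} → σ ⟨$⟩ʳ a ≡ σ ⟨$⟩ʳ c → a ≡ c
  ⟨$⟩ʳ-injective eq =
    trans (sym (inverseˡ σ)) (trans (cong (σ ⟨$⟩ˡ_) eq) (inverseˡ σ))

  ≼⇒column-≤ : ∀ {a c} → a ≼[ σ ] c → a ≤ c
  ≼⇒column-≤ (inj₁ refl)       = ℕₚ.≤-refl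
  ≼⇒column-≤ (inj₂ (a<c , _)) = ℕₚ.<⇒≤ a<c

  ≼⇒value-≤ : ∀ {a c} → a ≼[ σ ] c → σ ⟨$⟩ʳ a ≤ σ ⟨$⟩ʳ c
  ≼⇒value-≤ (inj₁ refl)        = ℕₚ.≤-refl
  ≼⇒value-≤ (inj₂ (_ , σa<σc)) = ℕₚ.<⇒≤ σa<σc

  -- An inversion between two upper (resp. lower) points, completed by the
  -- witness of the right (resp. left) one, is a 321.
  sameType-increasing : Avoids321 σ → ∀ {b a c} → HasType σ b a → HasType σ b c →
    a < c → σ ⟨$⟩ʳ a < σ ⟨$⟩ʳ c
  sameType-increasing av {b} {a} {c} ha hc a<c with <-cmp (σ ⟨$⟩ʳ a) (σ ⟨$⟩ʳ c)
  ... | tri< σa<σc _ _ = σa<σc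
  ... | tri≈ _ σa≡σc _ = ⊥-elim (<-irrefl (⟨$⟩ʳ-injective σa≡σc) a<c)
  sameType-increasing av {U} {a} {c} ha (d , c<d , σd<σc) a<c | tri> _ _ σc<σa =
    ⊥-elim (av (a , c , d , a<c , c<d , σd<σc , σc<σa))
  sameType-increasing av {L} {a} {c} (d , d<a , σa<σd) hc a<c | tri> _ _ σc<σa =
    ⊥-elim (av (d , a , c , d<a , a<c , σc<σa , σa<σd))

  column-≤⇒≼ : Avoids321 σ → ∀ {b a c} → HasType σ b a → HasType σ b c →
    a ≤ c → a ≼[ σ ] c
  column-≤⇒≼ av {a = a} {c} ha hc a≤c with <-cmp a c
  ... | tri< a<c _ _ = inj₂ (a<c , sameType-increasing av ha hc a<c)
  ... | tri≈ _ a≡c _ = inj₁ (sym a≡c)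
  ... | tri> _ _ c<a = ⊥-elim (ℕₚ.≤⇒≯ a≤c c<a)

  value-≤⇒≼ : Avoids321 σ → ∀ {b a c} → HasType σ b a → HasType σ b c →
    σ ⟨$⟩ʳ a ≤ σ ⟨$⟩ʳ c → a ≼[ σ ] c
  value-≤⇒≼ av {a = a} {c} ha hc σa≤σc with <-cmp a c
  ... | tri< a<c _ _ = inj₂ (a<c , sameType-increasing av ha hc a<c)
  ... | tri≈ _ a≡c _ = inj₁ (sym a≡c)
  ... | tri> _ _ c<a = ⊥-elim (ℕₚ.≤⇒≯ σa≤σc (sameType-increasing av hc ha c<a))

  rigid-hasType-T : Rigid σ → ∀ x → HasType σ (T σ x) x
  rigid-hasType-T rig x with upper? σ x | rig x
  ... | yes u  | _      = u
  ... | no ¬u  | inj₁ u = ⊥-elim (¬u u)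
  ... | no _   | inj₂ l = l

  left-< : ∀ {x y} → left σ x ≡ just y → y < x
  left-< {suc x} refl = ≤̄⇒inject₁< ℕₚ.≤-refl

  down-< : ∀ {x y} → down σ x ≡ just y → σ ⟨$⟩ʳ y < σ ⟨$⟩ʳ x
  down-< {x} eq with >>=-just {m = predFin (σ ⟨$⟩ʳ x)} eq
  ... | v , pv , refl rewrite inverseʳ σ {v} = left-< {x = σ ⟨$⟩ʳ x} pv

  typedRightOf? : Ty → Fin m → Fin m → Bool
  typedRightOf? b y j = ⌊ y <? j ⌋ ∧ hasType? σ b j

  typedAbove? : Ty → Fin m → Fin m → Bool
  typedAbove? b y v = ⌊ σ ⟨$⟩ʳ y <? v ⌋ ∧ hasType? σ b (σ ⟨$⟩ˡ v)

  ∧-hasType-sound : ∀ {c b j} → IsTrue (c ∧ hasType? σ b j) → HasType σ b j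
  ∧-hasType-sound {true} = hasType-sound

  ∧-hasType-complete : ∀ {A : Set} {d : Dec A} {b j} → A → HasType σ b j →
    IsTrue (⌊ d ⌋ ∧ hasType? σ b j)
  ∧-hasType-complete {d = yes _} _ = hasType-complete
  ∧-hasType-complete {d = no ¬a} a = ⊥-elim (¬a a)

  rightOf-≼ : Avoids321 σ → ∀ {b y z r} → HasType σ b z → y < z →
    rightOf σ b y ≡ just r → r ≼[ σ ] z
  rightOf-≼ av {b} {y} {z} {r} hz y<z found =
    column-≤⇒≼ av (∧-hasType-sound {⌊ y <? r ⌋} (findFirst-sound (typedRightOf? b y) found)) hz
      (findFirst-least (typedRightOf? b y) found (∧-hasType-complete y<z hz))

  upOf-≼ : Avoids321 σ → ∀ {b y z r} → HasType σ b z → σ ⟨$⟩ʳ y < σ ⟨$⟩ʳ z →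
    upOf σ b y ≡ just r → r ≼[ σ ] z
  upOf-≼ av {b} {y} {z} hz σy<σz eq with >>=-just {m = findFirst (typedAbove? b y)} eq
  ... | v , found , refl = value-≤⇒≼ av hr hz σr≤σz
    where
    hr : HasType σ b (σ ⟨$⟩ˡ v)
    hr = ∧-hasType-sound {⌊ σ ⟨$⟩ʳ y <? v ⌋} (findFirst-sound (typedAbove? b y) found)

    z-isCandidate : IsTrue (typedAbove? b y (σ ⟨$⟩ʳ z))
    z-isCandidate = ∧-hasType-complete σy<σz (subst (HasType σ b) (sym (inverseˡ σ)) hz)

    σr≤σz : σ ⟨$⟩ʳ (σ ⟨$⟩ˡ v) ≤ σ ⟨$⟩ʳ z
    σr≤σz rewrite inverseʳ σ {v} = findFirst-least (typedAbove? b y) found z-isCandidate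

embedding-preserves-type : ∀ {n m} {π : Permutation′ n} {τ : Permutation′ m} {e : Fin n → Fin m} →
  IsEmbedding π τ e → ∀ {b x} → HasType π b x → HasType τ b (e x)
embedding-preserves-type {e = e} emb {U} {x} (j , x<j , πj<πx) =
  e j , proj₁ (emb x j) x<j , proj₂ (emb j x) πj<πx
embedding-preserves-type {e = e} emb {L} {x} (j , j<x , πx<πj) =
  e j , proj₁ (emb j x) j<x , proj₂ (emb x j) πx<πj

maxM-≼M : ∀ {m} {τ : Permutation′ m} {z} {a c : Maybe (Fin m)} →
  (∀ {r} → a ≡ just r → r ≼[ τ ] z) → (∀ {r} → c ≡ just r → r ≼[ τ ] z) →
  maxM a c ≼M[ τ ] z
maxM-≼M {a = nothing} {nothing} _  _  = tt
maxM-≼M {a = nothing} {just y}  _  hc = hc refl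
maxM-≼M {a = just x}  {nothing} ha _  = ha refl
maxM-≼M {a = just x}  {just y}  ha hc with x ≤? y
... | yes _ = hc refl
... | no _  = ha refl

proposition6 : ∀ {n m} (π : Permutation′ n) (τ : Permutation′ m) →
    Avoids321 π → Rigid π → Avoids321 τ →
    (e f : Fin n → Fin m) →
    IsEmbedding π τ e → IsRigidMapping π τ f →
    ((x : Fin n) → f x ≼[ τ ] e x) →
    (x : Fin n) →
      maxM (left π x >>= λ y → rightOf τ (T π x) (f y))
           (down π x >>= λ y → upOf τ (T π x) (f y))
        ≼M[ τ ] e x
proposition6 π τ _ rig avτ e f emb _ f≼e x = maxM-≼M leftBound downBound
  where
  ex-hasType : HasType τ (T π x) (e x)
  ex-hasType = embedding-preserves-type emb (rigid-hasType-T {σ = π} rig x)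

  leftBound : ∀ {r} → (left π x >>= λ y → rightOf τ (T π x) (f y)) ≡ just r → r ≼[ τ ] e x
  leftBound eq with >>=-just {m = left π x} eq
  ... | y , ly , ry = rightOf-≼ avτ ex-hasType fy<ex ry
    where
    fy<ex : f y < e x
    fy<ex = ℕₚ.≤-<-trans (≼⇒column-≤ {σ = τ} (f≼e y)) (proj₁ (emb y x) (left-< {σ = π} ly))

  downBound : ∀ {r} → (down π x >>= λ y → upOf τ (T π x) (f y)) ≡ just r → r ≼[ τ ] e x
  downBound eq with >>=-just {m = down π x} eq
  ... | y , dy , uy = upOf-≼ avτ ex-hasType τfy<τex uy
    where
    τfy<τex : τ ⟨$⟩ʳ f y < τ ⟨$⟩ʳ e x
    τfy<τex = ℕₚ.≤-<-trans (≼⇒value-≤ {σ = τ} (f≼e y)) (proj₂ (emb y x) (down-< {σ = π} dy))
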